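{- Let $\mathcal{I}$ be a finite implication algebra contained in a Boolean algebra $B$ as an upper segment, let $b\in B$, and let $p=p_{b,I}$ be the profile of $\mathcal{I}$ at $b$. Then (a) $p$ is decreasing: if $\emptyset\neq S_1\subseteq S_2\subseteq M_I$ then $p(S_1)\ge p(S_2)$; (b) for any $S_1,S_2\subseteq M_I$ with $S_1\cap S_2\neq\emptyset$ we have $p(S_1)+p(S_2)\le p(S_1\cup S_2)+p(S_1\cap S_2)$.
   Context: An implication algebra is a set with a binary operation $\to$ satisfying $(x\to y)\to x=x$, $(x\to y)\to y=(y\to x)\to x$, $x\to(y\to z)=y\to(x\to z)$; "$\mathcal{I}$ contained in a Boolean algebra $B$ as an upper segment" means $\mathcal{I}$ is an upward-closed subset of $B$ with the inherited order and operation $x\to y=\neg x\vee y$. $M_I$ is the set of minimal elements of $\mathcal{I}$. For $b\in B$, the profile of $\mathcal{I}$ at $b$ is the function $p_{b,I}\colon\mathcal{P}(M_I)\setminus\{\emptyset\}\to\mathbb{N}$ with $p_{b,I}(S)=k$ iff the interval $[\bigvee S\vee b,\mathbf{1}]$ of $B$ is isomorphic to $2^k$. -}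

module Defs where

open import Level using (Level; _⊔_)
open import Data.Nat using (ℕ; zero; suc)
open import Data.Fin using (Fin; zero; suc)
open import Data.Fin.Subset using (Subset; _∈_; _⊆_; inside; outside)
open import Data.Vec using (_∷_; [])
open import Data.Product using (Σ; _×_; ∃)
open import Function using (_∘_; _⇔_)
open import Relation.Binary.PropositionalEquality using (_≡_)
open import Algebra.Lattice.Bundles using (BooleanAlgebra)

module _ {c ℓ : Level} (B : BooleanAlgebra c ℓ) where
  open BooleanAlgebra B

  _≤B_ : Carrier → Carrier → Set ℓ
  x ≤B y = (x ∨ y) ≈ y

  UpperSegment : ∀ {i} → (Carrier → Set i) → Set (c ⊔ ℓ ⊔ i)
  UpperSegment I = ∀ x y → I x → x ≤B y → I y

  Enumerates : ∀ {i} → (Carrier → Set i) → {n : ℕ} → (Fin n → Carrier) → Set (c ⊔ ℓ ⊔ i)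
  Enumerates I {n} e =
    (∀ j → I (e j)) ×
    (∀ j k → e j ≈ e k → j ≡ k) ×
    (∀ x → I x → ∃ λ j → e j ≈ x)

  Minimal : ∀ {i} → (Carrier → Set i) → Carrier → Set (c ⊔ ℓ ⊔ i)
  Minimal I m = I m × (∀ x → I x → x ≤B m → x ≈ m)

  ⋁ : ∀ {n} → (Fin n → Carrier) → Subset n → Carrier
  ⋁ e [] = ⊥
  ⋁ e (inside ∷ s) = e zero ∨ ⋁ (e ∘ suc) s
  ⋁ e (outside ∷ s) = ⋁ (e ∘ suc) s

  IntervalIso2^ : Carrier → ℕ → Set (c ⊔ ℓ)
  IntervalIso2^ a k = Σ (Subset k → Carrier) λ φ →
    (∀ s → a ≤B φ s) ×
    (∀ s t → (s ⊆ t) ⇔ (φ s ≤B φ t)) ×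
    (∀ x → a ≤B x → ∃ λ s → φ s ≈ x)

  -- S (given as a set of indices of the enumeration e) is a subset of M_I
  SubsetOfMin : ∀ {i} → (Carrier → Set i) → {n : ℕ} → (Fin n → Carrier) → Subset n → Set (c ⊔ ℓ ⊔ i)
  SubsetOfMin I e S = ∀ {j} → j ∈ S → Minimal I (e j)

  Profile : {n : ℕ} → (Fin n → Carrier) → Carrier → Subset n → ℕ → Set (c ⊔ ℓ)
  Profile e b S k = IntervalIso2^ (⋁ e S ∨ b) k

-- Write base(S) = ⋁S ∨ b, so that p(S) = k means [base(S), ⊤] ≅ 2^k.  The
-- whole argument rests on a codimension formula: if a ≤ a' and
-- [a, ⊤] ≅ 2^k, [a', ⊤] ≅ 2^j via φ and φ', then inside 2^k the interval
-- [a', ⊤] is the up-set of ρ(a') = φ⁻¹(a'), hence k = j + ∣ρ(a')∣.  Both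
-- inequalities come from one counting principle on finite powersets (the
-- chain bound): a function on 2^m bounded by k and strictly increasing along
-- proper inclusions above s satisfies f(s) + m ≤ k + ∣s∣, because a maximal
-- chain from s to the full set has m - ∣s∣ proper steps.
--
-- (a) follows since base is monotone, so p(S₁) = p(S₂) + ∣ρ(base S₂)∣.
-- (b) Measure everything inside [base(S₁ ∩ S₂), ⊤] ≅ 2^(p(S₁ ∩ S₂)): with
-- sᵢ = ρ(base Sᵢ) and s₃ = ρ(base (S₁ ∪ S₂)) we get s₃ ⊆ s₁ ∪ s₂ since
-- base (S₁ ∪ S₂) ≤ base S₁ ∨ base S₂, and (b) is the inequality
-- ∣s₃∣ ≤ ∣s₁∣ + ∣s₂∣ rewritten by the codimension formula.
module Submission where

open import Defs
open import Level using (Level)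
open import Data.Nat using (ℕ; zero; suc; _≤_; _<_; _+_; z≤n; s≤s)
open import Data.Nat.Properties
  using ( ≤-trans; ≤-antisym; ≤-reflexive; m≤n+m; n≤1+n; m<m+n
        ; +-comm; +-assoc; +-suc; +-identityʳ; +-monoˡ-≤; +-monoʳ-≤
        ; +-cancelʳ-≤; m≤n⇒∃[o]m+o≡n; module ≤-Reasoning )
open import Data.Fin using (Fin)
open import Data.Fin.Subset
  using (Subset; _∈_; _⊆_; _⊂_; _∪_; _∩_; ∣_∣; inside; outside; Nonempty)
  renaming (⊥ to ∅)
open import Data.Fin.Subset.Properties
  using ( ⊆-refl; ⊆-trans; drop-∷-⊆; out⊆; s⊆s; out⊂in; s⊂s; p⊂q⇒p⊆q
        ; ⊂-⊆-trans; ⊂-irref; p⊆q⇒∣p∣≤∣q∣; ∣p∣≤n; ∣⊥∣≡0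
        ; p∩q⊆p; p∩q⊆q; p⊆p∪q; q⊆p∪q; x∈p∪q⁻ )
open import Data.Vec using (_∷_; []; here; there)
open import Data.Product using (∃; _×_; _,_; proj₁; proj₂)
open import Data.Sum using ([_,_])
open import Function using (_∘_; Equivalence)
open import Relation.Nullary using (¬_; contradiction)
open import Relation.Binary.PropositionalEquality as ≡ using (_≡_)
open import Relation.Binary.Bundles using (Poset)
open import Relation.Binary.Lattice using (JoinSemilattice)
open import Algebra.Lattice.Bundles using (BooleanAlgebra)
import Algebra.Lattice.Properties.Lattice as LatticeProperties
import Algebra.Lattice.Properties.BooleanAlgebra as BooleanAlgebraProperties
import Relation.Binary.Lattice.Properties.JoinSemilattice as JoinSemilatticeProperties

⊆-⊉⇒∣<∣ : ∀ {n} {p q : Subset n} → p ⊆ q → ¬ (q ⊆ p) → ∣ p ∣ < ∣ q ∣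
⊆-⊉⇒∣<∣ {p = []}          {[]}          _   q⊈p = contradiction (λ ()) q⊈p
⊆-⊉⇒∣<∣ {p = outside ∷ p} {outside ∷ q} p⊆q q⊈p = ⊆-⊉⇒∣<∣ (drop-∷-⊆ p⊆q) (q⊈p ∘ out⊆)
⊆-⊉⇒∣<∣ {p = outside ∷ p} {inside  ∷ q} p⊆q _   = s≤s (p⊆q⇒∣p∣≤∣q∣ (drop-∷-⊆ p⊆q))
⊆-⊉⇒∣<∣ {p = inside  ∷ p} {outside ∷ q} p⊆q _   = contradiction (p⊆q here) λ ()
⊆-⊉⇒∣<∣ {p = inside  ∷ p} {inside  ∷ q} p⊆q q⊈p = s≤s (⊆-⊉⇒∣<∣ (drop-∷-⊆ p⊆q) (q⊈p ∘ s⊆s))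

∣p∪q∣≤∣p∣+∣q∣ : ∀ {n} (p q : Subset n) → ∣ p ∪ q ∣ ≤ ∣ p ∣ + ∣ q ∣
∣p∪q∣≤∣p∣+∣q∣ []            []            = z≤n
∣p∪q∣≤∣p∣+∣q∣ (outside ∷ p) (outside ∷ q) = ∣p∪q∣≤∣p∣+∣q∣ p q
∣p∪q∣≤∣p∣+∣q∣ (outside ∷ p) (inside  ∷ q) =
  ≤-trans (s≤s (∣p∪q∣≤∣p∣+∣q∣ p q)) (≤-reflexive (≡.sym (+-suc ∣ p ∣ ∣ q ∣)))
∣p∪q∣≤∣p∣+∣q∣ (inside  ∷ p) (outside ∷ q) = s≤s (∣p∪q∣≤∣p∣+∣q∣ p q)
∣p∪q∣≤∣p∣+∣q∣ (inside  ∷ p) (inside  ∷ q) =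
  s≤s (≤-trans (∣p∪q∣≤∣p∣+∣q∣ p q) (+-monoʳ-≤ ∣ p ∣ (n≤1+n ∣ q ∣)))

extend : ∀ {m} (x : Subset m) → ∣ x ∣ < m → ∃ λ y → x ⊂ y × ∣ y ∣ ≡ suc ∣ x ∣
extend (outside ∷ x) _ = inside ∷ x , out⊂in ⊆-refl , ≡.refl
extend (inside ∷ x) (s≤s ∣x∣<m) with extend x ∣x∣<m
... | y , x⊂y , ∣y∣≡1+∣x∣ = inside ∷ y , s⊂s x⊂y , ≡.cong suc ∣y∣≡1+∣x∣

-- Walking from s to the full set one element at a time takes m - ∣s∣ steps,
-- each raising f, so f s + m ≤ k + ∣ s ∣.
module _ {m k : ℕ} (f : Subset m → ℕ) (s : Subset m) (f≤k : ∀ x → f x ≤ k)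
         (f-strict : ∀ {x y} → s ⊆ x → x ⊂ y → f x < f y) where

  chain-steps : ∀ d x → s ⊆ x → ∣ x ∣ + d ≡ m → f x + d ≤ k
  chain-steps zero    x _   _ = ≤-trans (≤-reflexive (+-identityʳ (f x))) (f≤k x)
  chain-steps (suc d) x s⊆x ∣x∣+d≡m
    with extend x (≡.subst (∣ x ∣ <_) ∣x∣+d≡m (m<m+n ∣ x ∣ (s≤s z≤n)))
  ... | y , x⊂y , ∣y∣≡1+∣x∣ = begin
      f x + suc d    ≡⟨ +-suc (f x) d ⟩
      suc (f x) + d  ≤⟨ +-monoˡ-≤ d (f-strict s⊆x x⊂y) ⟩
      f y + d        ≤⟨ chain-steps d y (⊆-trans s⊆x (p⊂q⇒p⊆q x⊂y)) ∣y∣+d≡m ⟩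
      k              ∎
    where
      open ≤-Reasoning
      ∣y∣+d≡m : ∣ y ∣ + d ≡ m
      ∣y∣+d≡m = ≡.trans (≡.cong (_+ d) ∣y∣≡1+∣x∣)
                        (≡.trans (≡.sym (+-suc ∣ x ∣ d)) ∣x∣+d≡m)

  chain-bound : f s + m ≤ k + ∣ s ∣
  chain-bound with m≤n⇒∃[o]m+o≡n (∣p∣≤n s)
  ... | d , ∣s∣+d≡m = begin
      f s + m            ≡⟨ ≡.cong (f s +_) (≡.sym ∣s∣+d≡m) ⟩
      f s + (∣ s ∣ + d)  ≡⟨ ≡.cong (f s +_) (+-comm ∣ s ∣ d) ⟩
      f s + (d + ∣ s ∣)  ≡⟨ ≡.sym (+-assoc (f s) d ∣ s ∣) ⟩
      f s + d + ∣ s ∣    ≤⟨ +-monoˡ-≤ ∣ s ∣ (chain-steps d s ⊆-refl ∣s∣+d≡m) ⟩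
      k + ∣ s ∣          ∎
    where open ≤-Reasoning

supermodular-arith : ∀ {k₁ k₂ k₃ k₄ x y z} →
  k₄ ≡ k₁ + x → k₄ ≡ k₂ + y → k₄ ≡ k₃ + z → z ≤ x + y → k₁ + k₂ ≤ k₃ + k₄
supermodular-arith {k₁} {k₂} {k₃} {k₄} {x} {y} {z} eq₁ eq₂ eq₃ z≤x+y =
  +-cancelʳ-≤ (x + y) (k₁ + k₂) (k₃ + k₄) (begin
    k₁ + k₂ + (x + y)    ≡⟨ solve 5 (λ k₁ k₂ x y k₄ → k₁ :+ k₂ :+ (x :+ y)
                              := (k₁ :+ x) :+ (k₂ :+ y)) ≡.refl k₁ k₂ x y k₄ ⟩
    (k₁ + x) + (k₂ + y)  ≡⟨ ≡.cong₂ _+_ (≡.sym eq₁) (≡.sym eq₂) ⟩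
    k₄ + k₄              ≡⟨ ≡.cong (k₄ +_) eq₃ ⟩
    k₄ + (k₃ + z)        ≤⟨ +-monoʳ-≤ k₄ (+-monoʳ-≤ k₃ z≤x+y) ⟩
    k₄ + (k₃ + (x + y))  ≡⟨ solve 4 (λ k₃ k₄ x y → k₄ :+ (k₃ :+ (x :+ y))
                              := k₃ :+ k₄ :+ (x :+ y)) ≡.refl k₃ k₄ x y ⟩
    k₃ + k₄ + (x + y)    ∎)
  where
    open ≤-Reasoning
    open import Data.Nat.Solver using (module +-*-Solver)
    open +-*-Solver

module _ {c ℓ : Level} (B : BooleanAlgebra c ℓ) where

  open BooleanAlgebra B using (Carrier; _≈_; _∨_; ∨-comm; lattice)
    renaming (sym to ≈-sym; trans to ≈-trans)
  open BooleanAlgebraProperties B using (∨-identityʳ)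
  open JoinSemilattice (LatticeProperties.∨-orderTheoreticJoinSemilattice lattice)
    renaming (_≤_ to _⊑_) using (poset; x≤x∨y; y≤x∨y; ∨-least)
  open JoinSemilatticeProperties (LatticeProperties.∨-orderTheoreticJoinSemilattice lattice)
    using (x≤y⇒x∨y≈y; ∨-monotonic)
  module ⊑ = Poset poset

  -- The order x ≤B y (x ∨ y ≈ y) of the statement is the join-semilattice
  -- order of B, for which the library provides the order theory.
  ≤B⇒⊑ : ∀ {x y} → _≤B_ B x y → x ⊑ y
  ≤B⇒⊑ {x} {y} x∨y≈y = ≈-sym (≈-trans (∨-comm y x) x∨y≈y)

  ⊑⇒≤B : ∀ {x y} → x ⊑ y → _≤B_ B x y
  ⊑⇒≤B = x≤y⇒x∨y≈y

  ⋁-upper : ∀ {n} (e : Fin n → Carrier) {S : Subset n} {j} → j ∈ S → e j ⊑ ⋁ B e S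
  ⋁-upper e {inside  ∷ S} here        = x≤x∨y _ _
  ⋁-upper e {inside  ∷ S} (there j∈S) = ⊑.trans (⋁-upper (e ∘ Fin.suc) j∈S) (y≤x∨y _ _)
  ⋁-upper e {outside ∷ S} (there j∈S) = ⋁-upper (e ∘ Fin.suc) j∈S

  ⋁-least : ∀ {n} (e : Fin n → Carrier) (S : Subset n) {u} →
            (∀ {j} → j ∈ S → e j ⊑ u) → ⋁ B e S ⊑ u
  ⋁-least e []            {u} _  = ≈-sym (∨-identityʳ u)
  ⋁-least e (inside  ∷ S)     ub =
    ∨-least (ub here) (⋁-least (e ∘ Fin.suc) S (λ j∈S → ub (there j∈S)))
  ⋁-least e (outside ∷ S)     ub = ⋁-least (e ∘ Fin.suc) S (λ j∈S → ub (there j∈S))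

  ⋁-mono : ∀ {n} (e : Fin n → Carrier) {S T : Subset n} → S ⊆ T → ⋁ B e S ⊑ ⋁ B e T
  ⋁-mono e {S} S⊆T = ⋁-least e S (λ j∈S → ⋁-upper e (S⊆T j∈S))

  ⋁-∪ : ∀ {n} (e : Fin n → Carrier) (S T : Subset n) → ⋁ B e (S ∪ T) ⊑ ⋁ B e S ∨ ⋁ B e T
  ⋁-∪ e S T = ⋁-least e (S ∪ T) (λ j∈S∪T →
    [ (λ j∈S → ⊑.trans (⋁-upper e j∈S) (x≤x∨y _ _))
    , (λ j∈T → ⊑.trans (⋁-upper e j∈T) (y≤x∨y _ _)) ] (x∈p∪q⁻ S T j∈S∪T))

  -- An isomorphism φ : 2^k ≅ [a, ⊤] together with its inverse ρ, extended
  -- to all of B by ρ x = φ⁻¹ (x ∨ a).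
  module Interval {a : Carrier} {k : ℕ} (iso : IntervalIso2^ B a k) where

    φ : Subset k → Carrier
    φ = proj₁ iso

    φ-lower : ∀ s → a ⊑ φ s
    φ-lower s = ≤B⇒⊑ (proj₁ (proj₂ iso) s)

    φ-mono : ∀ {s t} → s ⊆ t → φ s ⊑ φ t
    φ-mono {s} {t} = ≤B⇒⊑ ∘ Equivalence.to (proj₁ (proj₂ (proj₂ iso)) s t)

    φ-reflect : ∀ {s t} → φ s ⊑ φ t → s ⊆ t
    φ-reflect {s} {t} = Equivalence.from (proj₁ (proj₂ (proj₂ iso)) s t) ∘ ⊑⇒≤B

    private
      preimage : ∀ x → ∃ λ s → φ s ≈ x ∨ a
      preimage x = proj₂ (proj₂ (proj₂ iso)) (x ∨ a) (⊑⇒≤B (y≤x∨y x a))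

    ρ : Carrier → Subset k
    ρ x = proj₁ (preimage x)

    φ∘ρ : ∀ {x} → a ⊑ x → φ (ρ x) ≈ x
    φ∘ρ {x} a⊑x = ≈-trans (proj₂ (preimage x)) (≈-trans (∨-comm x a) (x≤y⇒x∨y≈y a⊑x))

    ρ⊆⇒⊑φ : ∀ {x t} → a ⊑ x → ρ x ⊆ t → x ⊑ φ t
    ρ⊆⇒⊑φ a⊑x ρx⊆t = ⊑.≤-respˡ-≈ (φ∘ρ a⊑x) (φ-mono ρx⊆t)

    ⊑φ⇒ρ⊆ : ∀ {x t} → a ⊑ x → x ⊑ φ t → ρ x ⊆ t
    ⊑φ⇒ρ⊆ a⊑x x⊑φt = φ-reflect (⊑.≤-respˡ-≈ (≈-sym (φ∘ρ a⊑x)) x⊑φt)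

    ρ-mono : ∀ {x y} → a ⊑ x → x ⊑ y → ρ x ⊆ ρ y
    ρ-mono a⊑x x⊑y = ⊑φ⇒ρ⊆ a⊑x (⊑.≤-respʳ-≈ (≈-sym (φ∘ρ (⊑.trans a⊑x x⊑y))) x⊑y)

    ρ∘embedding-strict : ∀ {m} {ψ : Subset m → Carrier} →
      (∀ {s t} → s ⊆ t → ψ s ⊑ ψ t) → (∀ {s t} → ψ s ⊑ ψ t → s ⊆ t) →
      ∀ {x y} → a ⊑ ψ x → x ⊂ y → ∣ ρ (ψ x) ∣ < ∣ ρ (ψ y) ∣
    ρ∘embedding-strict {ψ = ψ} ψ-mono ψ-reflect {x} {y} a⊑ψx x⊂y =
      ⊆-⊉⇒∣<∣ (ρ-mono a⊑ψx ψx⊑ψy) ρψy⊈ρψx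
      where
        ψx⊑ψy : ψ x ⊑ ψ y
        ψx⊑ψy = ψ-mono (p⊂q⇒p⊆q x⊂y)
        ρψy⊈ρψx : ¬ (ρ (ψ y) ⊆ ρ (ψ x))
        ρψy⊈ρψx ρψy⊆ρψx =
          ⊂-irref ≡.refl (⊂-⊆-trans x⊂y
            (ψ-reflect (⊑.≤-respʳ-≈ (φ∘ρ a⊑ψx) (ρ⊆⇒⊑φ (⊑.trans a⊑ψx ψx⊑ψy) ρψy⊆ρψx))))

  -- Codimension formula: if a ⊑ a', [a, ⊤] ≅ 2^k and [a', ⊤] ≅ 2^j, then
  -- k = j + ∣ρ a'∣; the two inequalities are chain bounds for ρ' ∘ φ and ρ ∘ φ'.
  module _ {a a' : Carrier} {k j : ℕ} (iso : IntervalIso2^ B a k)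
           (iso' : IntervalIso2^ B a' j) (a⊑a' : a ⊑ a') where
    private
      module I  = Interval iso
      module I' = Interval iso'

    codim-lower : ∣ I.ρ a' ∣ + j ≤ k
    codim-lower = begin
        ∣ I.ρ a' ∣ + j           ≤⟨ +-monoˡ-≤ j (p⊆q⇒∣p∣≤∣q∣ (I.ρ-mono a⊑a' (I'.φ-lower ∅))) ⟩
        ∣ I.ρ (I'.φ ∅) ∣ + j     ≤⟨ chain-bound (λ t → ∣ I.ρ (I'.φ t) ∣) ∅
                                      (λ t → ∣p∣≤n (I.ρ (I'.φ t)))
                                      (λ _ → I.ρ∘embedding-strict I'.φ-mono I'.φ-reflect
                                               (⊑.trans a⊑a' (I'.φ-lower _))) ⟩
        k + ∣ ∅ {j} ∣            ≡⟨ ≡.cong (k +_) (∣⊥∣≡0 j) ⟩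
        k + 0                    ≡⟨ +-identityʳ k ⟩
        k                        ∎
      where open ≤-Reasoning

    codim-upper : k ≤ j + ∣ I.ρ a' ∣
    codim-upper = ≤-trans (m≤n+m k _)
      (chain-bound (λ x → ∣ I'.ρ (I.φ x) ∣) (I.ρ a') (λ x → ∣p∣≤n (I'.ρ (I.φ x)))
         (λ ρa'⊆x → I'.ρ∘embedding-strict I.φ-mono I.φ-reflect (I.ρ⊆⇒⊑φ a⊑a' ρa'⊆x)))

    codim : k ≡ j + ∣ I.ρ a' ∣
    codim = ≤-antisym codim-upper (≤-trans (≤-reflexive (+-comm j _)) codim-lower)

  module _ {n : ℕ} (e : Fin n → Carrier) (b : Carrier) where

    base : Subset n → Carrier
    base S = ⋁ B e S ∨ b

    base-mono : ∀ {S T} → S ⊆ T → base S ⊑ base T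
    base-mono S⊆T = ∨-monotonic (⋁-mono e S⊆T) ⊑.refl

    base-∪ : ∀ S T → base (S ∪ T) ⊑ base S ∨ base T
    base-∪ S T = ∨-least
      (⊑.trans (⋁-∪ e S T) (∨-monotonic (x≤x∨y _ b) (x≤x∨y _ b)))
      (⊑.trans (y≤x∨y (⋁ B e S) b) (x≤x∨y _ _))

    profile-antitone : ∀ {S T k₁ k₂} → S ⊆ T →
      Profile B e b S k₁ → Profile B e b T k₂ → k₂ ≤ k₁
    profile-antitone S⊆T p₁ p₂ = ≤-trans (m≤n+m _ _) (codim-lower p₁ p₂ (base-mono S⊆T))

    profile-supermodular : ∀ S₁ S₂ {k₁ k₂ k₃ k₄} →
      Profile B e b S₁ k₁ → Profile B e b S₂ k₂ →
      Profile B e b (S₁ ∪ S₂) k₃ → Profile B e b (S₁ ∩ S₂) k₄ → k₁ + k₂ ≤ k₃ + k₄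
    profile-supermodular S₁ S₂ {k₄ = k₄} p₁ p₂ p₃ p₄ =
      supermodular-arith {x = ∣ s₁ ∣} {y = ∣ s₂ ∣} {z = ∣ s₃ ∣}
        (codim p₄ p₁ ∩⊑₁) (codim p₄ p₂ ∩⊑₂) (codim p₄ p₃ ∩⊑∪)
        (≤-trans (p⊆q⇒∣p∣≤∣q∣ s₃⊆s₁∪s₂) (∣p∪q∣≤∣p∣+∣q∣ s₁ s₂))
      where
        module I = Interval p₄
        ∩⊑₁ : base (S₁ ∩ S₂) ⊑ base S₁
        ∩⊑₁ = base-mono (p∩q⊆p S₁ S₂)
        ∩⊑₂ : base (S₁ ∩ S₂) ⊑ base S₂
        ∩⊑₂ = base-mono (p∩q⊆q S₁ S₂)
        ∩⊑∪ : base (S₁ ∩ S₂) ⊑ base (S₁ ∪ S₂)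
        ∩⊑∪ = base-mono (⊆-trans (p∩q⊆p S₁ S₂) (p⊆p∪q S₂))
        s₁ s₂ s₃ : Subset k₄
        s₁ = I.ρ (base S₁)
        s₂ = I.ρ (base S₂)
        s₃ = I.ρ (base (S₁ ∪ S₂))
        s₃⊆s₁∪s₂ : s₃ ⊆ s₁ ∪ s₂
        s₃⊆s₁∪s₂ = I.⊑φ⇒ρ⊆ ∩⊑∪ (⊑.trans (base-∪ S₁ S₂)
          (∨-least (I.ρ⊆⇒⊑φ ∩⊑₁ (p⊆p∪q s₂)) (I.ρ⊆⇒⊑φ ∩⊑₂ (q⊆p∪q s₁ s₂))))

lemma4p2 : ∀ {c ℓ i : Level} (B : BooleanAlgebra c ℓ)
    (I : BooleanAlgebra.Carrier B → Set i) → UpperSegment B I →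
    (n : ℕ) (e : Fin n → BooleanAlgebra.Carrier B) → Enumerates B I e →
    (b : BooleanAlgebra.Carrier B) →
    ((S₁ S₂ : Subset n) → SubsetOfMin B I e S₁ → SubsetOfMin B I e S₂ →
       Nonempty S₁ → S₁ ⊆ S₂ →
       (k₁ k₂ : ℕ) → Profile B e b S₁ k₁ → Profile B e b S₂ k₂ → k₂ ≤ k₁)
    ×
    ((S₁ S₂ : Subset n) → SubsetOfMin B I e S₁ → SubsetOfMin B I e S₂ →
       Nonempty (S₁ ∩ S₂) →
       (k₁ k₂ k₃ k₄ : ℕ) → Profile B e b S₁ k₁ → Profile B e b S₂ k₂ →
       Profile B e b (S₁ ∪ S₂) k₃ → Profile B e b (S₁ ∩ S₂) k₄ →
       k₁ + k₂ ≤ k₃ + k₄)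
lemma4p2 B _ _ _ e _ b =
  (λ _ _ _ _ _ S₁⊆S₂ _ _ → profile-antitone B e b S₁⊆S₂) ,
  (λ S₁ S₂ _ _ _ _ _ _ _ → profile-supermodular B e b S₁ S₂)
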